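{- Let $a,b$ be odd integers. For every $k\geq 1$, the graphs $C^{(a,b)}(k)$ and $B(2,k)$ are isomorphic, and the map $\Phi^{(a,b)}_k:\{0,\ldots,2^k-1\}\to\{0,\ldots,2^k-1\}$, $\Phi^{(a,b)}_k(n)=\sum_{i=0}^{k-1} x^{(a,b)}_i(n)\,2^i$, is an isomorphism from $C^{(a,b)}(k)$ to $B(2,k)$. Furthermore, the graphs $C^{(a,b)}(\mathbb{Z}_2)$ and $B(\mathbb{Z}_2)$ are isomorphic, and the map $\Phi^{(a,b)}:\mathbb{Z}_2\to\mathbb{Z}_2$, $\Phi^{(a,b)}(n)=\sum_{i=0}^{\infty} x^{(a,b)}_i(n)\,2^i$, is an isomorphism from $C^{(a,b)}(\mathbb{Z}_2)$ to $B(\mathbb{Z}_2)$ satisfying $T^{(a,b)} = (\Phi^{(a,b)})^{ -1}\circ\sigma_2\circ\Phi^{(a,b)}$.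
   Context: All graphs are directed. $\mathbb{Z}_2$ denotes the $2$-adic integers. For odd integers $a,b$, the $an+b$ function $T^{(a,b)}$ (on $\mathbb{Z}$ or on $\mathbb{Z}_2$) is $T^{(a,b)}(n)=(an+b)/2$ if $n$ is odd and $T^{(a,b)}(n)=n/2$ if $n$ is even. Let $x^{(a,b)}_i(n)\in\{0,1\}$ be defined by $x^{(a,b)}_i(n)\equiv (T^{(a,b)})^i(n)\pmod 2$ (the $i$-th iterate, with the $0$-th iterate being $n$). $C^{(a,b)}(k)$ is the directed graph with vertex set $\{0,\ldots,2^k-1\}$ and an edge from $u$ to $v$ iff there exist integers $u_1\equiv u$, $v_1\equiv v \pmod{2^k}$ with $T^{(a,b)}(u_1)=v_1$. $C^{(a,b)}(\mathbb{Z}_2)$ has vertex set $\mathbb{Z}_2$ and edges $n\to T^{(a,b)}(n)$. The binary De Bruijn graph $B(2,k)$ has vertex set $\{0,\ldots,2^k-1\}$, a number $\sum_{i=0}^{k-1}b_i2^i$ ($b_i\in\{0,1\}$) identified with the word $b_0\cdots b_{k-1}$, and an edge from $a_0\cdots a_{k-1}$ to $b_0\cdots b_{k-1}$ iff $a_{i+1}=b_i$ for $i=0,\ldots,k-2$. The shift map $\sigma_2:\mathbb{Z}_2\to\mathbb{Z}_2$ is $\sigma_2(n)=(n-1)/2$ for odd $n$ and $n/2$ for even $n$, and $B(\mathbb{Z}_2)$ is the graph with vertex set $\mathbb{Z}_2$ and edges $n\to\sigma_2(n)$. -}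

module Defs where

open import Data.Bool using (Bool; true; false; if_then_else_)
open import Data.Nat as ℕ using (ℕ; zero; suc; _<_; _≡ᵇ_; NonZero)
open import Data.Nat.Properties using (m^n≢0)
import Data.Nat.DivMod as ℕD
open import Data.Fin using (Fin; toℕ)
open import Data.Integer as ℤ using (ℤ; +_)
open import Data.Integer.DivMod using (_%ℕ_; _/ℕ_)
open import Data.Integer.Divisibility using (_∣_)
open import Data.Product using (Σ; _×_; ∃)
open import Function using (_⇔_)
open import Function.Definitions using (Congruent; Bijective; Inverseᵇ)
open import Relation.Binary.PropositionalEquality using (_≡_)
open import Relation.Nullary using (¬_)


Odd : ℤ → Set
Odd a = ¬ ((+ 2) ∣ a)

iter : {A : Set} → (A → A) → ℕ → A → A
iter f zero    x = x
iter f (suc i) x = f (iter f i x)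

sumTo : ℕ → (ℕ → ℕ) → ℕ
sumTo zero    f = 0
sumTo (suc k) f = sumTo k f ℕ.+ f k

T : ℤ → ℤ → ℤ → ℤ
T a b n = if (n %ℕ 2) ≡ᵇ 1 then ((a ℤ.* n ℤ.+ b) /ℕ 2) else (n /ℕ 2)

x : ℤ → ℤ → ℕ → ℤ → ℕ
x a b i n = iter (T a b) i n %ℕ 2

Vtx : ℕ → Set
Vtx k = Fin (2 ℕ.^ k)

Graph : Set → Set₁
Graph V = V → V → Set

C : ℤ → ℤ → (k : ℕ) → Graph (Vtx k)
C a b k u v = Σ ℤ λ u₁ → Σ ℤ λ v₁ →
  (_%ℕ_ u₁ (2 ℕ.^ k) {{m^n≢0 2 k}} ≡ toℕ u) × (_%ℕ_ v₁ (2 ℕ.^ k) {{m^n≢0 2 k}} ≡ toℕ v) × (T a b u₁ ≡ v₁)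

bitℕ : ℕ → ℕ → ℕ
bitℕ n i = ℕD._/_ n (2 ℕ.^ i) {{m^n≢0 2 i}} ℕD.% 2

B : (k : ℕ) → Graph (Vtx k)
B k u v = ∀ i → suc i < k → bitℕ (toℕ u) (suc i) ≡ bitℕ (toℕ v) i

-- Φ_k(n) = Σ_{i<k} x_i(n) 2^i  (this sum is < 2^k, so the final
-- reduction mod 2^k, needed only to land in Fin (2^k), is the identity)
Φk : ℤ → ℤ → (k : ℕ) → Vtx k → Vtx k
Φk a b k n = ℕD._mod_ (sumTo k (λ i → x a b i (+ toℕ n) ℕ.* 2 ℕ.^ i)) (2 ℕ.^ k) {{m^n≢0 2 k}}

IsIso : {V W : Set} → Graph V → Graph W → (V → W) → Set
IsIso E F f = Bijective _≡_ _≡_ f × (∀ u v → E u v ⇔ F (f u) (f v))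

Isomorphic : {V W : Set} → Graph V → Graph W → Set
Isomorphic {V} {W} E F = Σ (V → W) λ f → IsIso E F f

-- 2-adic integers as digit streams: n = Σ_i n(i) 2^i, with equality
-- of 2-adic integers being equality of all digits.

ℤ₂ : Set
ℤ₂ = ℕ → Bool

_≈_ : ℤ₂ → ℤ₂ → Set
s ≈ t = ∀ i → s i ≡ t i

bitToℕ : Bool → ℕ
bitToℕ true  = 1
bitToℕ false = 0

trunc : ℤ₂ → ℕ → ℕ
trunc s m = sumTo m (λ j → bitToℕ (s j) ℕ.* 2 ℕ.^ j)

-- i-th 2-adic digit of an integer (two's complement for negatives)
bitℤ : ℤ → ℕ → Bool
bitℤ z i = ℕD._/_ (_%ℕ_ z (2 ℕ.^ suc i) {{m^n≢0 2 (suc i)}}) (2 ℕ.^ i) {{m^n≢0 2 i}} ≡ᵇ 1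

-- T^{(a,b)} on ℤ₂: digit i of T(n) depends only on n mod 2^{i+2}, and
-- equals digit i of T applied to the integer n mod 2^{i+2}.
T₂ : ℤ → ℤ → ℤ₂ → ℤ₂
T₂ a b s i = bitℤ (T a b (+ trunc s (suc (suc i)))) i

σ₂ : ℤ₂ → ℤ₂
σ₂ s i = s (suc i)

-- Φ^{(a,b)}(n) = Σ_i x_i(n) 2^i, with x_i(n) = (T^i n) mod 2 = digit 0 of T^i n
Φ : ℤ → ℤ → ℤ₂ → ℤ₂
Φ a b n i = iter (T₂ a b) i n 0

Cℤ₂ : ℤ → ℤ → Graph ℤ₂
Cℤ₂ a b u v = v ≈ T₂ a b u

Bℤ₂ : Graph ℤ₂
Bℤ₂ u v = v ≈ σ₂ u

IsIso₂ : Graph ℤ₂ → Graph ℤ₂ → (ℤ₂ → ℤ₂) → Set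
IsIso₂ E F f = Congruent _≈_ _≈_ f × Bijective _≈_ _≈_ f
  × (∀ u v → E u v ⇔ F (f u) (f v))

Isomorphic₂ : Graph ℤ₂ → Graph ℤ₂ → Set
Isomorphic₂ E F = Σ (ℤ₂ → ℤ₂) λ f → IsIso₂ E F f

module Submission where

-- Let a, b be odd and T = T^(a,b).  The whole theorem rests on one fact about
-- congruences:
--
--   z ≡ z' (mod 2^k)  iff  z and z' have the same parities x_0, …, x_{k-1}.
--
-- It follows by induction on k from the behaviour of T on residues: integers of
-- equal parity are congruent mod 2^(k+1) iff their images under T are congruent
-- mod 2^k, because T multiplies the difference of the halves by 1 or by the odd
-- number a, and odd numbers are units modulo 2^k.
--
-- Finite case.  Φ_k(n) is the number whose binary digits are the first k
-- parities of n, so that fact makes Φ_k injective, hence bijective on the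
-- finite set {0, …, 2^k-1}; since x_i(T n) = x_{i+1}(n), an edge u → v of C(k)
-- (i.e. T u ≡ v mod 2^(k-1), using a lifting lemma) is exactly a De Bruijn edge
-- between Φ_k u and Φ_k v.
--
-- 2-adic case.  Digit i of T₂^j(s) is computed from a truncation of s, so digit
-- i of Φ(s) is x_i of any long enough truncation of s.  The inverse Ψ takes the
-- digits of the preimages under Φ_M of the truncations of y; these preimages are
-- coherent by the same fact, and Φ ∘ T₂ = σ₂ ∘ Φ holds by construction.

open import Defs
open import Data.Bool using (true; false)
open import Data.Empty using (⊥-elim)
open import Data.Fin as Fin using (Fin; toℕ)
import Data.Fin.Properties as Finₚ
open import Data.Integer as ℤ using (ℤ; +_; _+_; _*_; _-_; -_; ∣_∣)
import Data.Integer.Properties as ℤₚ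
open import Data.Integer.DivMod using (_%ℕ_; _/ℕ_; a≡a%ℕn+[a/ℕn]*n; n%ℕd<d)
open import Data.Integer.Divisibility.Signed as Signed
  using (_∣_; divides; ∣ᵤ⇒∣; ∣⇒∣ᵤ; ∣-trans; ∣m+n∣n⇒∣m; ∣n⇒∣m*n)
open import Data.Integer.Tactic.RingSolver using (solve-∀)
open import Data.Nat.Tactic.RingSolver using () renaming (solve-∀ to solveℕ-∀)
open import Data.Nat as ℕ using (ℕ; zero; suc; _≤_; _<_; _≥_; z≤n; s≤s; NonZero; _≡ᵇ_)
import Data.Nat.Properties as ℕₚ
open import Data.Nat.Properties using (m^n≢0)
import Data.Nat.DivMod as ℕ
import Data.Nat.Divisibility as ℕ
open import Data.Nat.Primality using (euclidsLemma; prime[2])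
open import Data.Product using (Σ; _×_; _,_; proj₁; proj₂)
open import Data.Sum using (_⊎_; inj₁; inj₂)
open import Function.Bundles using (_⇔_; mk⇔; Equivalence)
open import Relation.Binary.PropositionalEquality
open import Relation.Nullary using (yes; no)
open import Function.Definitions using (Injective; StrictlySurjective; Bijective; Congruent; Inverseᵇ)
open import Function.Consequences using (inverseᵇ⇒bijective)
open import Function.Consequences.Propositional using (strictlySurjective⇒surjective)

infix 4 _≡_[mod_]

_≡_[mod_] : ℤ → ℤ → ℕ → Set
z ≡ z' [mod d ] = + d ∣ z - z'

≡-mod-sym : ∀ {d z z'} → z ≡ z' [mod d ] → z' ≡ z [mod d ]
≡-mod-sym {d} {z} {z'} z≡z' = subst (+ d ∣_) (negated-difference z z') (Signed.∣m⇒∣-m z≡z')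
  where
  negated-difference : ∀ z z' → - (z - z') ≡ z' - z
  negated-difference = solve-∀

≡-mod-trans : ∀ {d z y w} → z ≡ y [mod d ] → y ≡ w [mod d ] → z ≡ w [mod d ]
≡-mod-trans {d} {z} {y} {w} p q =
  subst (+ d ∣_) (ℤₚ.+-minus-telescope z y w) (Signed.∣m∣n⇒∣m+n p q)

≡-mod-1 : ∀ z z' → z ≡ z' [mod 1 ]
≡-mod-1 z z' = divides (z - z') (sym (ℤₚ.*-identityʳ (z - z')))

≡-mod-∣ : ∀ {d e z z'} → d ℕ.∣ e → z ≡ z' [mod e ] → z ≡ z' [mod d ]
≡-mod-∣ d∣e = ∣-trans (∣ᵤ⇒∣ d∣e)

remainder-unique : ∀ {d r r'} → r < d → r' < d → + r ≡ + r' [mod d ] → r ≡ r'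
remainder-unique {d} {r} {r'} r<d r'<d d∣r-r' =
  ℤₚ.+-injective (ℤₚ.i-j≡0⇒i≡j (+ r) (+ r')
    (ℤₚ.∣i∣≡0⇒i≡0 (small-multiple (∣⇒∣ᵤ d∣r-r') ∣r-r'∣<d)))
  where
  ∣r-r'∣<d : ∣ + r - + r' ∣ < d
  ∣r-r'∣<d = subst (_< d) (cong ∣_∣ (sym (ℤₚ.m-n≡m⊖n r r')))
    (ℕₚ.≤-<-trans (ℤₚ.∣m⊝n∣≤m⊔n r r') (ℕₚ.⊔-lub r<d r'<d))
  small-multiple : ∀ {m} → d ℕ.∣ m → m < d → m ≡ 0
  small-multiple {zero}  _   _   = refl
  small-multiple {suc m} d∣m m<d = ⊥-elim (ℕₚ.<⇒≱ m<d (ℕ.∣⇒≤ d∣m))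

≡-mod⇔%ℕ : ∀ {d} .{{_ : NonZero d}} z z' → z ≡ z' [mod d ] ⇔ (z %ℕ d ≡ z' %ℕ d)
≡-mod⇔%ℕ {d} z z' = mk⇔ to from
  where
  r = z %ℕ d ; q = z /ℕ d ; r' = z' %ℕ d ; q' = z' /ℕ d
  difference : z - z' ≡ (+ r - + r') + (q - q') * + d
  difference = trans (cong₂ _-_ (a≡a%ℕn+[a/ℕn]*n z d) (a≡a%ℕn+[a/ℕn]*n z' d)) (regroup (+ r) (+ r') q q' (+ d))
    where
    regroup : ∀ r r' q q' d → (r + q * d) - (r' + q' * d) ≡ (r - r') + (q - q') * d
    regroup = solve-∀
  to : z ≡ z' [mod d ] → r ≡ r'
  to d∣z-z' = remainder-unique (n%ℕd<d z d) (n%ℕd<d z' d)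
    (∣m+n∣n⇒∣m (subst (+ d ∣_) difference d∣z-z') (divides (q - q') refl))
  from : r ≡ r' → z ≡ z' [mod d ]
  from r≡r' = divides (q - q') (trans difference (trans (cong (_+ (q - q') * + d) cancel) (ℤₚ.+-identityˡ _)))
    where
    cancel : + r - + r' ≡ + 0
    cancel = trans (cong (λ s → + s - + r') r≡r') (ℤₚ.+-inverseʳ (+ r'))

/ℕ-exact : ∀ {d} .{{_ : NonZero d}} q → (q * + d) /ℕ d ≡ q
/ℕ-exact {d} q = ℤₚ.*-cancelʳ-≡ _ q (+ d) (begin
  (m /ℕ d) * + d               ≡⟨ ℤₚ.+-identityˡ _ ⟨
  + 0 + (m /ℕ d) * + d         ≡⟨ cong (λ r → + r + (m /ℕ d) * + d) remainder≡0 ⟨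
  + (m %ℕ d) + (m /ℕ d) * + d  ≡⟨ a≡a%ℕn+[a/ℕn]*n m d ⟨
  m                            ∎)
  where
  open ≡-Reasoning
  m = q * + d
  remainder≡0 : m %ℕ d ≡ 0
  remainder≡0 = trans (Equivalence.to (≡-mod⇔%ℕ m (+ 0)) (divides q (ℤₚ.+-identityʳ m)))
    (ℕ.m*n%n≡0 0 d)

parity : ℤ → ℕ
parity n = n %ℕ 2

half : ℤ → ℤ
half n = n /ℕ 2

parity-half : ∀ n → n ≡ + parity n + half n * + 2
parity-half n = a≡a%ℕn+[a/ℕn]*n n 2

parity-bit : ∀ n → parity n ≡ 0 ⊎ parity n ≡ 1
parity-bit n with parity n | n%ℕd<d n 2
... | 0 | _ = inj₁ refl
... | 1 | _ = inj₂ refl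
... | suc (suc _) | s≤s (s≤s ())

odd-parity-form : ∀ m → parity m ≡ 1 → m ≡ + 1 + half m * + 2
odd-parity-form m p≡1 = trans (parity-half m) (cong (λ r → + r + half m * + 2) p≡1)

odd⇒parity≡1 : ∀ a → Odd a → parity a ≡ 1
odd⇒parity≡1 a odd-a with parity-bit a
... | inj₂ p≡1 = p≡1
... | inj₁ p≡0 = ⊥-elim (odd-a (∣⇒∣ᵤ (divides (half a) a≡2h)))
  where
  a≡2h : a ≡ half a * + 2
  a≡2h = trans (parity-half a) (trans (cong (λ r → + r + half a * + 2) p≡0) (ℤₚ.+-identityˡ _))

odd-1 : Odd (+ 1)
odd-1 2∣1 with ℕ.∣1⇒≡1 2∣1
... | ()

same-parity-difference : ∀ z z' → parity z ≡ parity z' → z - z' ≡ (half z - half z') * + 2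
same-parity-difference z z' eq = begin
  z - z'                                         ≡⟨ cong₂ _-_ (parity-half z) (parity-half z') ⟩
  (+ parity z + half z * + 2) - (+ p' + h' * + 2) ≡⟨ cong (λ r → (+ r + half z * + 2) - (+ p' + h' * + 2)) eq ⟩
  (+ p' + half z * + 2) - (+ p' + h' * + 2)       ≡⟨ regroup (+ p') (half z) h' ⟩
  (half z - h') * + 2                             ∎
  where
  open ≡-Reasoning
  p' = parity z'
  h' = half z'
  regroup : ∀ r h h' → (r + h * + 2) - (r + h' * + 2) ≡ (h - h') * + 2
  regroup = solve-∀

even-cofactor : ∀ u {w} → Odd u → + 2 ∣ u * w → + 2 ∣ w
even-cofactor u {w} odd-u 2∣uw
  with euclidsLemma ∣ u ∣ ∣ w ∣ prime[2] (subst (2 ℕ.∣_) (ℤₚ.abs-* u w) (∣⇒∣ᵤ 2∣uw))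
... | inj₁ 2∣u = ⊥-elim (odd-u 2∣u)
... | inj₂ 2∣w = ∣ᵤ⇒∣ 2∣w

odd-cancel : ∀ u → Odd u → ∀ k {w} → + (2 ℕ.^ k) ∣ u * w → + (2 ℕ.^ k) ∣ w
odd-cancel _ _     zero    {w} _          = divides w (sym (ℤₚ.*-identityʳ w))
odd-cancel u odd-u (suc k) {w} 2^[1+k]∣uw
  with even-cofactor u odd-u (∣-trans (∣ᵤ⇒∣ {+ 2} (ℕ.m∣m*n (2 ℕ.^ k))) 2^[1+k]∣uw)
... | divides h refl = subst₂ _∣_ (sym 2^[1+k]≡2*2^k) (ℤₚ.*-comm (+ 2) h)
        (Signed.*-monoʳ-∣ (+ 2) (odd-cancel u odd-u k (Signed.*-cancelˡ-∣ (+ 2) 2*2^k∣2*uh)))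
  where
  2^[1+k]≡2*2^k : + (2 ℕ.^ suc k) ≡ + 2 * + (2 ℕ.^ k)
  2^[1+k]≡2*2^k = ℤₚ.pos-* 2 (2 ℕ.^ k)
  rearrange : ∀ u h → u * (h * + 2) ≡ + 2 * (u * h)
  rearrange = solve-∀
  2*2^k∣2*uh : + 2 * + (2 ℕ.^ k) ∣ + 2 * (u * h)
  2*2^k∣2*uh = subst₂ _∣_ 2^[1+k]≡2*2^k (rearrange u h) 2^[1+k]∣uw

≡-mod-parity : ∀ d z z' → z ≡ z' [mod 2 ℕ.* d ] → parity z ≡ parity z'
≡-mod-parity d z z' c = Equivalence.to (≡-mod⇔%ℕ z z') (≡-mod-∣ {z = z} {z' = z'} (ℕ.m∣m*n d) c)

≡-mod-halves : ∀ d z z' → parity z ≡ parity z' →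
               z ≡ z' [mod 2 ℕ.* d ] ⇔ half z ≡ half z' [mod d ]
≡-mod-halves d z z' same = mk⇔
  (λ c → Signed.*-cancelʳ-∣ (+ 2) (subst₂ _∣_ 2d≡d*2 (same-parity-difference z z' same) c))
  (λ c → subst₂ _∣_ (sym 2d≡d*2) (sym (same-parity-difference z z' same)) (Signed.*-monoˡ-∣ (+ 2) c))
  where
  2d≡d*2 : + (2 ℕ.* d) ≡ + d * + 2
  2d≡d*2 = trans (cong +_ (ℕₚ.*-comm 2 d)) (ℤₚ.pos-* d 2)

half-translate : ∀ z q → half (z + q * + 2) - half z ≡ q
half-translate z q = ℤₚ.*-cancelʳ-≡ _ _ (+ 2) (begin
  (half z₁ - half z) * + 2  ≡⟨ same-parity-difference z₁ z (≡-mod-parity 1 z₁ z (divides q z₁-z)) ⟨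
  z₁ - z                    ≡⟨ z₁-z ⟩
  q * + 2                   ∎)
  where
  open ≡-Reasoning
  z₁ = z + q * + 2
  cancel : ∀ z w → (z + w) - z ≡ w
  cancel = solve-∀
  z₁-z : z₁ - z ≡ q * + 2
  z₁-z = cancel z (q * + 2)

T-even : ∀ a b n → parity n ≡ 0 → T a b n ≡ half n
T-even a b n p≡0 rewrite p≡0 = refl

Agree : {A : Set} → ℕ → (ℕ → A) → (ℕ → A) → Set
Agree k f g = ∀ i → i < k → f i ≡ g i

iter-shift : ∀ {A : Set} (f : A → A) i y → iter f (suc i) y ≡ iter f i (f y)
iter-shift f zero    y = refl
iter-shift f (suc i) y = cong f (iter-shift f i y)

2^m∣2^k : ∀ {m k} → m ≤ k → 2 ℕ.^ m ℕ.∣ 2 ℕ.^ k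
2^m∣2^k {m} m≤k with ℕₚ.m≤n⇒∃[o]m+o≡n m≤k
... | o , refl = ℕ.divides (2 ℕ.^ o) (trans (ℕₚ.^-distribˡ-+-* 2 m o) (ℕₚ.*-comm (2 ℕ.^ m) (2 ℕ.^ o)))

Bits : (ℕ → ℕ) → Set
Bits d = ∀ i → d i ℕ.≤ 1

expand : ℕ → (ℕ → ℕ) → ℕ
expand k d = sumTo k (λ i → d i ℕ.* 2 ℕ.^ i)

expand-< : ∀ k {d} → Bits d → expand k d < 2 ℕ.^ k
expand-< zero    _    = s≤s z≤n
expand-< (suc k) {d} bits = begin-strict
  expand k d ℕ.+ d k ℕ.* 2 ℕ.^ k <⟨ ℕₚ.+-mono-<-≤ (expand-< k bits) top-digit ⟩
  2 ℕ.^ k ℕ.+ 2 ℕ.^ k             ≡⟨ cong (2 ℕ.^ k ℕ.+_) (ℕₚ.+-identityʳ (2 ℕ.^ k)) ⟨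
  2 ℕ.^ suc k                     ∎
  where
  open ℕₚ.≤-Reasoning
  top-digit : d k ℕ.* 2 ℕ.^ k ≤ 2 ℕ.^ k
  top-digit = ℕₚ.≤-trans (ℕₚ.*-monoˡ-≤ (2 ℕ.^ k) (bits k)) (ℕₚ.≤-reflexive (ℕₚ.*-identityˡ (2 ℕ.^ k)))

expand-split : ∀ d j m → Σ ℕ λ t → expand (suc m ℕ.+ j) d ≡ expand j d ℕ.+ (d j ℕ.+ t ℕ.* 2) ℕ.* 2 ℕ.^ j
expand-split d j zero = 0 , cong (λ c → expand j d ℕ.+ c ℕ.* 2 ℕ.^ j) (sym (ℕₚ.+-identityʳ (d j)))
expand-split d j (suc m) with expand-split d j m
... | t , eq = t ℕ.+ D ℕ.* 2 ℕ.^ m , (begin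
  expand (suc m ℕ.+ j) d ℕ.+ D ℕ.* 2 ℕ.^ (suc m ℕ.+ j)
    ≡⟨ cong₂ (λ e p → e ℕ.+ D ℕ.* p) eq (ℕₚ.^-distribˡ-+-* 2 (suc m) j) ⟩
  expand j d ℕ.+ (d j ℕ.+ t ℕ.* 2) ℕ.* 2 ℕ.^ j ℕ.+ D ℕ.* (2 ℕ.* 2 ℕ.^ m ℕ.* 2 ℕ.^ j)
    ≡⟨ regroup (expand j d) (d j) t D (2 ℕ.^ m) (2 ℕ.^ j) ⟩
  expand j d ℕ.+ (d j ℕ.+ (t ℕ.+ D ℕ.* 2 ℕ.^ m) ℕ.* 2) ℕ.* 2 ℕ.^ j ∎)
  where
  open ≡-Reasoning
  D = d (suc m ℕ.+ j)
  regroup : ∀ e c t D M J → e ℕ.+ (c ℕ.+ t ℕ.* 2) ℕ.* J ℕ.+ D ℕ.* (2 ℕ.* M ℕ.* J)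
                          ≡ e ℕ.+ (c ℕ.+ (t ℕ.+ D ℕ.* M) ℕ.* 2) ℕ.* J
  regroup = solveℕ-∀

bitℕ-digit : ∀ j {r c} t → r < 2 ℕ.^ j → c ℕ.≤ 1 → bitℕ (r ℕ.+ (c ℕ.+ t ℕ.* 2) ℕ.* 2 ℕ.^ j) j ≡ c
bitℕ-digit j {r} {c} t r<2^j c≤1 = begin
  (r ℕ.+ w ℕ.* 2 ℕ.^ j) ℕ./ 2 ℕ.^ j ℕ.% 2
    ≡⟨ cong (ℕ._% 2) (ℕ.+-distrib-/-∣ʳ r (ℕ.n∣m*n w)) ⟩
  (r ℕ./ 2 ℕ.^ j ℕ.+ w ℕ.* 2 ℕ.^ j ℕ./ 2 ℕ.^ j) ℕ.% 2
    ≡⟨ cong₂ (λ p q → (p ℕ.+ q) ℕ.% 2) (ℕ.m<n⇒m/n≡0 r<2^j) (ℕ.m*n/n≡m w (2 ℕ.^ j)) ⟩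
  (c ℕ.+ t ℕ.* 2) ℕ.% 2                                   ≡⟨ ℕ.[m+kn]%n≡m%n c t 2 ⟩
  c ℕ.% 2                                                 ≡⟨ ℕ.m<n⇒m%n≡m (s≤s c≤1) ⟩
  c                                                       ∎
  where
  open ≡-Reasoning
  w = c ℕ.+ t ℕ.* 2
  instance _ = m^n≢0 2 j

bitℕ-expand : ∀ k {d} → Bits d → Agree k (bitℕ (expand k d)) d
bitℕ-expand k {d} bits j j<k with ℕₚ.m≤n⇒∃[o]m+o≡n j<k
... | m , refl with expand-split d j m
... | t , eq = trans (cong (λ n → bitℕ n j) (trans (cong (λ n → expand n d) (cong suc (ℕₚ.+-comm j m))) eq))
                    (bitℕ-digit j t (expand-< j bits) (bits j))

expand-cong : ∀ k {d e} → Agree k d e → expand k d ≡ expand k e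
expand-cong zero    _     = refl
expand-cong (suc k) agree = cong₂ ℕ._+_
  (expand-cong k λ i i<k → agree i (ℕₚ.m<n⇒m<1+n i<k))
  (cong (ℕ._* 2 ℕ.^ k) (agree k ℕₚ.≤-refl))

module _ {P : ℕ} .{{_ : NonZero P}} where
  private instance
    2P≢0 : NonZero (2 ℕ.* P)
    2P≢0 = ℕₚ.m*n≢0 2 P

  %-double : ∀ n → n ℕ.% (2 ℕ.* P) ≡ n ℕ.% P ℕ.+ (n ℕ./ P ℕ.% 2) ℕ.* P
  %-double n = begin
    n ℕ.% (2 ℕ.* P)                     ≡⟨ cong (ℕ._% (2 ℕ.* P)) (trans (ℕ.m≡m%n+[m/n]*n n P)
                                                                       (ℕₚ.+-comm (n ℕ.% P) _)) ⟩
    (q ℕ.* P ℕ.+ n ℕ.% P) ℕ.% (2 ℕ.* P) ≡⟨ ℕ.[m*n+o]%[p*n]≡[m*n]%[p*n]+o q 2 (ℕ.m%n<n n P) ⟩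
    q ℕ.* P ℕ.% (2 ℕ.* P) ℕ.+ n ℕ.% P   ≡⟨ cong (ℕ._+ n ℕ.% P) (ℕ.m%n*o≡m*o%[n*o] q 2 P) ⟨
    q ℕ.% 2 ℕ.* P ℕ.+ n ℕ.% P           ≡⟨ ℕₚ.+-comm (q ℕ.% 2 ℕ.* P) (n ℕ.% P) ⟩
    n ℕ.% P ℕ.+ q ℕ.% 2 ℕ.* P           ∎
    where
    open ≡-Reasoning
    q = n ℕ./ P

expand-bitℕ : ∀ m n → expand m (bitℕ n) ≡ ℕ._%_ n (2 ℕ.^ m) {{m^n≢0 2 m}}
expand-bitℕ zero    n = sym (ℕ.n%1≡0 n)
expand-bitℕ (suc m) n = trans (cong (ℕ._+ bitℕ n m ℕ.* 2 ℕ.^ m) (expand-bitℕ m n))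
  (sym (%-double {{m^n≢0 2 m}} n))

bitℕ≤1 : ∀ n i → bitℕ n i ℕ.≤ 1
bitℕ≤1 n i = ℕₚ.≤-pred (ℕ.m%n<n (ℕ._/_ n (2 ℕ.^ i) {{m^n≢0 2 i}}) 2)

bitToℕ-≡ᵇ1 : ∀ {c} → c ℕ.≤ 1 → bitToℕ (c ≡ᵇ 1) ≡ c
bitToℕ-≡ᵇ1 z≤n       = refl
bitToℕ-≡ᵇ1 (s≤s z≤n) = refl

≡ᵇ1-bitToℕ : ∀ c → (bitToℕ c ≡ᵇ 1) ≡ c
≡ᵇ1-bitToℕ true  = refl
≡ᵇ1-bitToℕ false = refl

bitToℕ-bits : ∀ (s : ℤ₂) → Bits (λ i → bitToℕ (s i))
bitToℕ-bits s i with s i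
... | true  = s≤s z≤n
... | false = z≤n

bitℤ-cong : ∀ j z z' → z ≡ z' [mod 2 ℕ.^ suc j ] → bitℤ z j ≡ bitℤ z' j
bitℤ-cong j z z' c = cong (λ r → r ℕ./ 2 ℕ.^ j ≡ᵇ 1)
  (Equivalence.to (≡-mod⇔%ℕ z z') c)
  where instance
    _ = m^n≢0 2 j
    _ = m^n≢0 2 (suc j)

bitℤ-nat : ∀ n j → bitℤ (+ n) j ≡ (bitℕ n j ≡ᵇ 1)
bitℤ-nat n j = cong (_≡ᵇ 1) (ℕ.m%[n*o]/o≡m/o%n n 2 (2 ℕ.^ j))
  where instance
    _ = m^n≢0 2 j
    _ = m^n≢0 2 (suc j)

bitℤ-trunc : ∀ M s → Agree M (bitℤ (+ trunc s M)) s
bitℤ-trunc M s j j<M = begin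
  bitℤ (+ trunc s M) j              ≡⟨ bitℤ-nat (trunc s M) j ⟩
  (bitℕ (trunc s M) j ≡ᵇ 1)         ≡⟨ cong (_≡ᵇ 1) (bitℕ-expand M (bitToℕ-bits s) j j<M) ⟩
  (bitToℕ (s j) ≡ᵇ 1)               ≡⟨ ≡ᵇ1-bitToℕ (s j) ⟩
  s j                               ∎
  where open ≡-Reasoning

trunc-cong : ∀ m {s t} → Agree m s t → trunc s m ≡ trunc t m
trunc-cong m agree = expand-cong m λ i i<m → cong bitToℕ (agree i i<m)

trunc-bitℤ : ∀ z m → + trunc (bitℤ z) m ≡ z [mod 2 ℕ.^ m ]
trunc-bitℤ z m = subst (λ n → + n ≡ z [mod 2 ℕ.^ m ]) (sym trunc≡R) R≡z
  where
  instance _ = m^n≢0 2 m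
  R = z %ℕ 2 ℕ.^ m
  R≡z : + R ≡ z [mod 2 ℕ.^ m ]
  R≡z = Equivalence.from (≡-mod⇔%ℕ (+ R) z) (ℕ.m<n⇒m%n≡m (n%ℕd<d z (2 ℕ.^ m)))
  digits : Agree m (λ j → bitToℕ (bitℤ z j)) (bitℕ R)
  digits j j<m = begin
    bitToℕ (bitℤ z j)           ≡⟨ cong bitToℕ (bitℤ-cong j z (+ R) (≡-mod-∣ {z = z} {z' = + R} (2^m∣2^k j<m)
                                                                    (≡-mod-sym {z = + R} {z' = z} R≡z))) ⟩
    bitToℕ (bitℤ (+ R) j)       ≡⟨ cong bitToℕ (bitℤ-nat R j) ⟩
    bitToℕ (bitℕ R j ≡ᵇ 1)      ≡⟨ bitToℕ-≡ᵇ1 (bitℕ≤1 R j) ⟩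
    bitℕ R j                    ∎
    where open ≡-Reasoning
  trunc≡R : trunc (bitℤ z) m ≡ R
  trunc≡R = trans (expand-cong m digits) (trans (expand-bitℕ m R) (ℕ.m<n⇒m%n≡m (n%ℕd<d z (2 ℕ.^ m))))

injective⇒onto : ∀ {N} (f : Fin N → Fin N) → Injective _≡_ _≡_ f → StrictlySurjective _≡_ f
injective⇒onto {zero}  f _   ()
injective⇒onto {suc N} f inj y with Finₚ.any? (λ u → f u Finₚ.≟ y)
... | yes hit = hit
... | no miss = ⊥-elim (ℕₚ.1+n≰n (Finₚ.injective⇒≤ {f = avoid-y} avoid-y-injective))
  where
  avoid-y : Fin (suc N) → Fin N
  avoid-y u = Fin.punchOut {i = y} (λ y≡fu → miss (u , sym y≡fu))
  avoid-y-injective : Injective _≡_ _≡_ avoid-y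
  avoid-y-injective {u} {v} eq =
    inj (Finₚ.punchOut-injective (λ y≡fu → miss (u , sym y≡fu)) (λ y≡fv → miss (v , sym y≡fv)) eq)

truncation-vertex : ∀ M → ℤ₂ → Vtx M
truncation-vertex M y = Fin.fromℕ< (expand-< M (bitToℕ-bits y))

vertex-residue : ∀ k (n : Vtx k) → _%ℕ_ (+ toℕ n) (2 ℕ.^ k) {{m^n≢0 2 k}} ≡ toℕ n
vertex-residue k n = ℕ.m<n⇒m%n≡m {{m^n≢0 2 k}} (Finₚ.toℕ<n n)

≈-refl : ∀ {s : ℤ₂} → s ≈ s
≈-refl i = refl

≈-sym : ∀ {s t : ℤ₂} → s ≈ t → t ≈ s
≈-sym s≈t i = sym (s≈t i)

≈-trans : ∀ {s t u : ℤ₂} → s ≈ t → t ≈ u → s ≈ u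
≈-trans s≈t t≈u i = trans (s≈t i) (t≈u i)

module AnPlusB (a b : ℤ) (odd-a : Odd a) (odd-b : Odd b) where

  T-odd : ∀ n → parity n ≡ 1 → T a b n ≡ a * half n + (half a + half b + + 1)
  T-odd n p≡1 rewrite p≡1 =
    trans (cong (_/ℕ 2) a*n+b≡) (/ℕ-exact (a * half n + (half a + half b + + 1)))
    where
    odd-product : ∀ a n b α h β → a ≡ + 1 + α * + 2 → n ≡ + 1 + h * + 2 → b ≡ + 1 + β * + 2 →
             a * n + b ≡ (a * h + (α + β + + 1)) * + 2
    odd-product _ _ _ α h β refl refl refl = polynomial α h β
      where
      polynomial : ∀ α h β → (+ 1 + α * + 2) * (+ 1 + h * + 2) + (+ 1 + β * + 2)
                           ≡ ((+ 1 + α * + 2) * h + (α + β + + 1)) * + 2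
      polynomial = solve-∀
    a*n+b≡ : a * n + b ≡ (a * half n + (half a + half b + + 1)) * + 2
    a*n+b≡ = odd-product a n b (half a) (half n) (half b)
      (odd-parity-form a (odd⇒parity≡1 a odd-a)) (odd-parity-form n p≡1) (odd-parity-form b (odd⇒parity≡1 b odd-b))

  T-difference : ∀ z z' → parity z ≡ parity z' →
                 Σ ℤ λ u → Odd u × (T a b z - T a b z' ≡ u * (half z - half z'))
  T-difference z z' same with parity-bit z
  ... | inj₁ p≡0 = + 1 , odd-1 , (begin
    T a b z - T a b z'       ≡⟨ cong₂ _-_ (T-even a b z p≡0) (T-even a b z' (trans (sym same) p≡0)) ⟩
    half z - half z'         ≡⟨ ℤₚ.*-identityˡ _ ⟨
    + 1 * (half z - half z') ∎)
    where open ≡-Reasoning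
  ... | inj₂ p≡1 = a , odd-a , (begin
    T a b z - T a b z'                   ≡⟨ cong₂ _-_ (T-odd z p≡1)
                                                      (T-odd z' (trans (sym same) p≡1)) ⟩
    (a * half z + c) - (a * half z' + c) ≡⟨ factor a (half z) (half z') c ⟩
    a * (half z - half z')               ∎)
    where
    open ≡-Reasoning
    c = half a + half b + + 1
    factor : ∀ a h h' c → (a * h + c) - (a * h' + c) ≡ a * (h - h')
    factor = solve-∀

  T-≡-mod : ∀ k z z' → parity z ≡ parity z' →
            z ≡ z' [mod 2 ℕ.^ suc k ] ⇔ T a b z ≡ T a b z' [mod 2 ℕ.^ k ]
  T-≡-mod k z z' same with T-difference z z' same
  ... | u , odd-u , diff = mk⇔
    (λ c → subst (+ (2 ℕ.^ k) ∣_) (sym diff) (∣n⇒∣m*n u (Equivalence.to (≡-mod-halves (2 ℕ.^ k) z z' same) c)))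
    (λ c → Equivalence.from (≡-mod-halves (2 ℕ.^ k) z z' same) (odd-cancel u odd-u k (subst (+ (2 ℕ.^ k) ∣_) diff c)))

  T-preserves-≡-mod : ∀ k z z' → z ≡ z' [mod 2 ℕ.^ suc k ] → T a b z ≡ T a b z' [mod 2 ℕ.^ k ]
  T-preserves-≡-mod k z z' c = Equivalence.to (T-≡-mod k z z' (≡-mod-parity (2 ℕ.^ k) z z' c)) c

  -- Lifting: if T z ≡ v mod 2^k then some z₁ ≡ z mod 2^(k+1) has T z₁ ≡ v mod 2^(k+1);
  -- moving z by -2p 2^k moves T z by -u p 2^k with u odd, which corrects T z - v = p 2^k.
  T-lift : ∀ k z v → T a b z ≡ v [mod 2 ℕ.^ k ] →
           Σ ℤ λ z₁ → z₁ ≡ z [mod 2 ℕ.^ suc k ] × T a b z₁ ≡ v [mod 2 ℕ.^ suc k ]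
  T-lift k z v (divides p Tz-v≡pP) = z₁ , z₁≡z , lifted (T-difference z₁ z same)
    where
    open ≡-Reasoning
    P = + (2 ℕ.^ k)
    2^[1+k]≡2P : + (2 ℕ.^ suc k) ≡ + 2 * P
    2^[1+k]≡2P = ℤₚ.pos-* 2 (2 ℕ.^ k)
    z₁ = z + (- p * P) * + 2
    z₁≡z : z₁ ≡ z [mod 2 ℕ.^ suc k ]
    z₁≡z = divides (- p) (trans (step z p P) (cong (- p *_) (sym 2^[1+k]≡2P)))
      where
      step : ∀ z p P → (z + (- p * P) * + 2) - z ≡ - p * (+ 2 * P)
      step = solve-∀
    same : parity z₁ ≡ parity z
    same = ≡-mod-parity (2 ℕ.^ k) z₁ z z₁≡z
    lifted : Σ ℤ (λ u → Odd u × (T a b z₁ - T a b z ≡ u * (half z₁ - half z))) →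
             T a b z₁ ≡ v [mod 2 ℕ.^ suc k ]
    lifted (u , odd-u , diff) = divides (- (half u * p)) (begin
      T a b z₁ - v                             ≡⟨ ℤₚ.+-minus-telescope (T a b z₁) (T a b z) v ⟨
      (T a b z₁ - T a b z) + (T a b z - v)      ≡⟨ cong₂ _+_ (trans diff (cong (u *_) (half-translate z (- p * P))))
                                                            Tz-v≡pP ⟩
      u * (- p * P) + p * P                     ≡⟨ cong (λ w → w * (- p * P) + p * P)
                                                        (odd-parity-form u (odd⇒parity≡1 u odd-u)) ⟩
      (+ 1 + half u * + 2) * (- p * P) + p * P  ≡⟨ cancel (half u) p P ⟩
      - (half u * p) * (+ 2 * P)                ≡⟨ cong (- (half u * p) *_) 2^[1+k]≡2P ⟨
      - (half u * p) * + (2 ℕ.^ suc k)          ∎)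
      where
      cancel : ∀ h p P → (+ 1 + h * + 2) * (- p * P) + p * P ≡ - (h * p) * (+ 2 * P)
      cancel = solve-∀

  x-shift : ∀ i z → x a b (suc i) z ≡ x a b i (T a b z)
  x-shift i z = cong (_%ℕ 2) (iter-shift (T a b) i z)

  ≡-mod⇒same-parities : ∀ k z z' → z ≡ z' [mod 2 ℕ.^ k ] → Agree k (λ i → x a b i z) (λ i → x a b i z')
  ≡-mod⇒same-parities (suc k) z z' c zero    _         = ≡-mod-parity (2 ℕ.^ k) z z' c
  ≡-mod⇒same-parities (suc k) z z' c (suc i) (s≤s i<k) = begin
    x a b (suc i) z         ≡⟨ x-shift i z ⟩
    x a b i (T a b z)       ≡⟨ ≡-mod⇒same-parities k (T a b z) (T a b z') (T-preserves-≡-mod k z z' c) i i<k ⟩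
    x a b i (T a b z')      ≡⟨ x-shift i z' ⟨
    x a b (suc i) z'        ∎
    where open ≡-Reasoning

  same-parities⇒≡-mod : ∀ k z z' → Agree k (λ i → x a b i z) (λ i → x a b i z') → z ≡ z' [mod 2 ℕ.^ k ]
  same-parities⇒≡-mod zero    z z' _     = ≡-mod-1 z z'
  same-parities⇒≡-mod (suc k) z z' agree = Equivalence.from (T-≡-mod k z z' (agree 0 (s≤s z≤n)))
    (same-parities⇒≡-mod k (T a b z) (T a b z') λ i i<k →
      trans (sym (x-shift i z)) (trans (agree (suc i) (s≤s i<k)) (x-shift i z')))

  parities-are-bits : ∀ z → Bits (λ i → x a b i z)
  parities-are-bits z i = ℕₚ.≤-pred (n%ℕd<d (iter (T a b) i z) 2)

  bit-Φk : ∀ k n → Agree k (bitℕ (toℕ (Φk a b k n))) (λ i → x a b i (+ toℕ n))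
  bit-Φk k n i i<k = trans (cong (λ m → bitℕ m i) toℕ-Φk) (bitℕ-expand k (parities-are-bits (+ toℕ n)) i i<k)
    where
    toℕ-Φk : toℕ (Φk a b k n) ≡ expand k (λ i → x a b i (+ toℕ n))
    toℕ-Φk = trans (Finₚ.toℕ-fromℕ< _) (ℕ.m<n⇒m%n≡m {{m^n≢0 2 k}} (expand-< k (parities-are-bits (+ toℕ n))))

  -- Φ_k is injective: equal parity vectors force equal residues mod 2^k.
  Φk-injective : ∀ k → Injective _≡_ _≡_ (Φk a b k)
  Φk-injective k {u} {v} eq = Finₚ.toℕ-injective (begin
    toℕ u                                 ≡⟨ vertex-residue k u ⟨
    _%ℕ_ (+ toℕ u) (2 ℕ.^ k) {{m^n≢0 2 k}} ≡⟨ Equivalence.to (≡-mod⇔%ℕ {{m^n≢0 2 k}} (+ toℕ u) (+ toℕ v))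
                                                (same-parities⇒≡-mod k (+ toℕ u) (+ toℕ v) same-parities) ⟩
    _%ℕ_ (+ toℕ v) (2 ℕ.^ k) {{m^n≢0 2 k}} ≡⟨ vertex-residue k v ⟩
    toℕ v                                 ∎)
    where
    open ≡-Reasoning
    same-parities : Agree k (λ i → x a b i (+ toℕ u)) (λ i → x a b i (+ toℕ v))
    same-parities i i<k = trans (sym (bit-Φk k u i i<k))
                                (trans (cong (λ m → bitℕ (toℕ m) i) eq) (bit-Φk k v i i<k))

  Φk-bijective : ∀ k → Bijective _≡_ _≡_ (Φk a b k)
  Φk-bijective k = Φk-injective k
                 , strictlySurjective⇒surjective (injective⇒onto (Φk a b k) (Φk-injective k))

  ≡-mod-vertex : ∀ k z (n : Vtx k) → z ≡ + toℕ n [mod 2 ℕ.^ k ] ⇔ (_%ℕ_ z (2 ℕ.^ k) {{m^n≢0 2 k}} ≡ toℕ n)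
  ≡-mod-vertex k z n = mk⇔
    (λ c → trans (Equivalence.to (≡-mod⇔%ℕ {{m^n≢0 2 k}} z (+ toℕ n)) c) (vertex-residue k n))
    (λ r → Equivalence.from (≡-mod⇔%ℕ {{m^n≢0 2 k}} z (+ toℕ n)) (trans r (sym (vertex-residue k n))))

  C-edge : ∀ m u v → C a b (suc m) u v ⇔ T a b (+ toℕ u) ≡ + toℕ v [mod 2 ℕ.^ m ]
  C-edge m u v = mk⇔ to from
    where
    to : C a b (suc m) u v → T a b (+ toℕ u) ≡ + toℕ v [mod 2 ℕ.^ m ]
    to (u₁ , v₁ , u₁≡u , v₁≡v , refl) = ≡-mod-trans {z = T a b (+ toℕ u)} {y = T a b u₁}
      (≡-mod-sym {z = T a b u₁}
        (T-preserves-≡-mod m u₁ (+ toℕ u) (Equivalence.from (≡-mod-vertex (suc m) u₁ u) u₁≡u)))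
      (≡-mod-∣ {z = T a b u₁} {z' = + toℕ v} (ℕ.n∣m*n 2)
        (Equivalence.from (≡-mod-vertex (suc m) (T a b u₁) v) v₁≡v))
    from : T a b (+ toℕ u) ≡ + toℕ v [mod 2 ℕ.^ m ] → C a b (suc m) u v
    from c = lifted (T-lift m (+ toℕ u) (+ toℕ v) c)
      where
      lifted : Σ ℤ (λ z₁ → z₁ ≡ + toℕ u [mod 2 ℕ.^ suc m ] × T a b z₁ ≡ + toℕ v [mod 2 ℕ.^ suc m ]) →
               C a b (suc m) u v
      lifted (z₁ , z₁≡u , Tz₁≡v) = z₁ , T a b z₁ , Equivalence.to (≡-mod-vertex (suc m) z₁ u) z₁≡u
                                 , Equivalence.to (≡-mod-vertex (suc m) (T a b z₁) v) Tz₁≡v , refl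

  -- Φ u → Φ v is an edge of B(m+1) iff T u ≡ v (mod 2^m): digits 1…m of Φ u are
  -- the parities x_0 … x_{m-1} of T u.
  B-edge : ∀ m u v → B (suc m) (Φk a b (suc m) u) (Φk a b (suc m) v) ⇔ T a b (+ toℕ u) ≡ + toℕ v [mod 2 ℕ.^ m ]
  B-edge m u v = mk⇔
    (λ shifted → same-parities⇒≡-mod m (T a b (+ toℕ u)) (+ toℕ v) λ i i<m → begin
      x a b i (T a b (+ toℕ u))              ≡⟨ x-shift i (+ toℕ u) ⟨
      x a b (suc i) (+ toℕ u)                ≡⟨ bit-Φk (suc m) u (suc i) (s≤s i<m) ⟨
      bitℕ (toℕ (Φk a b (suc m) u)) (suc i)  ≡⟨ shifted i (s≤s i<m) ⟩
      bitℕ (toℕ (Φk a b (suc m) v)) i        ≡⟨ bit-Φk (suc m) v i (ℕₚ.m<n⇒m<1+n i<m) ⟩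
      x a b i (+ toℕ v)                      ∎)
    (λ c i 1+i<1+m → let i<m = ℕₚ.≤-pred 1+i<1+m in begin
      bitℕ (toℕ (Φk a b (suc m) u)) (suc i)  ≡⟨ bit-Φk (suc m) u (suc i) 1+i<1+m ⟩
      x a b (suc i) (+ toℕ u)                ≡⟨ x-shift i (+ toℕ u) ⟩
      x a b i (T a b (+ toℕ u))              ≡⟨ ≡-mod⇒same-parities m (T a b (+ toℕ u)) (+ toℕ v) c i i<m ⟩
      x a b i (+ toℕ v)                      ≡⟨ bit-Φk (suc m) v i (ℕₚ.m<n⇒m<1+n i<m) ⟨
      bitℕ (toℕ (Φk a b (suc m) v)) i        ∎)
    where open ≡-Reasoning

  Φk-isomorphism : ∀ k → k ≥ 1 → IsIso (C a b k) (B k) (Φk a b k)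
  Φk-isomorphism (suc m) _ = Φk-bijective (suc m) , λ u v →
    mk⇔ (λ e → Equivalence.from (B-edge m u v) (Equivalence.to (C-edge m u v) e))
        (λ e → Equivalence.from (C-edge m u v) (Equivalence.to (B-edge m u v) e))

  iterT₂-digit : ∀ i j s M → i ℕ.+ j < M → iter (T₂ a b) i s j ≡ bitℤ (iter (T a b) i (+ trunc s M)) j
  iterT₂-digit zero    j s M j<M = sym (bitℤ-trunc M s j j<M)
  iterT₂-digit (suc i) j s M i+j<M =
    bitℤ-cong j (T a b (+ trunc s' (2 ℕ.+ j))) (T a b N)
      (T-preserves-≡-mod (suc j) (+ trunc s' (2 ℕ.+ j)) N truncation≡N)
    where
    s' = iter (T₂ a b) i s
    N = iter (T a b) i (+ trunc s M)
    s'-digits : Agree (2 ℕ.+ j) s' (bitℤ N)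
    s'-digits j' j'<2+j = iterT₂-digit i j' s M
      (ℕₚ.≤-<-trans (ℕₚ.+-monoʳ-≤ i (ℕₚ.≤-pred j'<2+j)) (subst (_< M) (sym (ℕₚ.+-suc i j)) i+j<M))
    truncation≡N : + trunc s' (2 ℕ.+ j) ≡ N [mod 2 ℕ.^ (2 ℕ.+ j) ]
    truncation≡N = subst (λ n → + n ≡ N [mod 2 ℕ.^ (2 ℕ.+ j) ])
                         (sym (trunc-cong (2 ℕ.+ j) s'-digits)) (trunc-bitℤ N (2 ℕ.+ j))

  Φ-digit : ∀ s i M → i < M → Φ a b s i ≡ (x a b i (+ trunc s M) ≡ᵇ 1)
  Φ-digit s i M i<M = trans (iterT₂-digit i 0 s M (subst (_< M) (sym (ℕₚ.+-identityʳ i)) i<M))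
                            (cong (_≡ᵇ 1) (ℕ.n/1≡n (x a b i (+ trunc s M))))

  -- Φ respects equality of 2-adic integers (digit i only sees the first i+1 digits).
  Φ-cong : Congruent _≈_ _≈_ (Φ a b)
  Φ-cong {s} {t} s≈t i = begin
    Φ a b s i                             ≡⟨ Φ-digit s i (suc i) ℕₚ.≤-refl ⟩
    (x a b i (+ trunc s (suc i)) ≡ᵇ 1)    ≡⟨ cong (λ n → x a b i (+ n) ≡ᵇ 1) (trunc-cong (suc i) λ j _ → s≈t j) ⟩
    (x a b i (+ trunc t (suc i)) ≡ᵇ 1)    ≡⟨ Φ-digit t i (suc i) ℕₚ.≤-refl ⟨
    Φ a b t i                             ∎
    where open ≡-Reasoning

  Φ-T₂ : ∀ s → Φ a b (T₂ a b s) ≈ σ₂ (Φ a b s)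
  Φ-T₂ s i = cong (λ t → t 0) (sym (iter-shift (T₂ a b) i s))

  preimage : ∀ M y → Σ (Vtx M) λ n → Φk a b M n ≡ truncation-vertex M y
  preimage M y = injective⇒onto (Φk a b M) (Φk-injective M) (truncation-vertex M y)

  solution : ℕ → ℤ₂ → ℤ
  solution M y = + toℕ (proj₁ (preimage M y))

  solution-parities : ∀ M y → Agree M (λ i → x a b i (solution M y)) (λ i → bitToℕ (y i))
  solution-parities M y i i<M = begin
    x a b i (+ toℕ n)                         ≡⟨ bit-Φk M n i i<M ⟨
    bitℕ (toℕ (Φk a b M n)) i                 ≡⟨ cong (λ m → bitℕ (toℕ m) i) (proj₂ (preimage M y)) ⟩
    bitℕ (toℕ (truncation-vertex M y)) i      ≡⟨ cong (λ m → bitℕ m i)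
                                                       (Finₚ.toℕ-fromℕ< (expand-< M (bitToℕ-bits y))) ⟩
    bitℕ (trunc y M) i                        ≡⟨ bitℕ-expand M (bitToℕ-bits y) i i<M ⟩
    bitToℕ (y i)                              ∎
    where
    open ≡-Reasoning
    n = proj₁ (preimage M y)

  solution-unique : ∀ M y z → Agree M (λ i → x a b i z) (λ i → bitToℕ (y i)) → z ≡ solution M y [mod 2 ℕ.^ M ]
  solution-unique M y z parities = same-parities⇒≡-mod M z (solution M y)
    λ i i<M → trans (parities i i<M) (sym (solution-parities M y i i<M))

  Ψ : ℤ₂ → ℤ₂
  Ψ y i = bitℤ (solution (suc i) y) i

  -- The solutions are coherent, so Ψ(y) is congruent to the M-th solution mod 2^M.
  Ψ-trunc : ∀ M y → + trunc (Ψ y) M ≡ solution M y [mod 2 ℕ.^ M ]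
  Ψ-trunc M y = subst (λ n → + n ≡ N [mod 2 ℕ.^ M ]) (sym (trunc-cong M coherent)) (trunc-bitℤ N M)
    where
    N = solution M y
    coherent : Agree M (Ψ y) (bitℤ N)
    coherent j j<M = bitℤ-cong j (solution (suc j) y) N (≡-mod-sym {z = N} {z' = solution (suc j) y}
      (solution-unique (suc j) y N λ i i≤j → solution-parities M y i (ℕₚ.<-≤-trans i≤j j<M)))

  Ψ-cong : Congruent _≈_ _≈_ Ψ
  Ψ-cong {y} {y'} y≈y' i = bitℤ-cong i (solution (suc i) y) (solution (suc i) y')
    (solution-unique (suc i) y' (solution (suc i) y)
      λ j j≤i → trans (solution-parities (suc i) y j j≤i) (cong bitToℕ (y≈y' j)))

  -- Φ(Ψ y) = y: digit i of Φ(Ψ y) is x_i of a truncation of Ψ y, i.e. of a solution for y.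
  Φ-Ψ : ∀ y → Φ a b (Ψ y) ≈ y
  Φ-Ψ y i = begin
    Φ a b (Ψ y) i                           ≡⟨ Φ-digit (Ψ y) i (suc i) ℕₚ.≤-refl ⟩
    (x a b i truncation ≡ᵇ 1)               ≡⟨ cong (_≡ᵇ 1) (≡-mod⇒same-parities (suc i) truncation
                                                  (solution (suc i) y) (Ψ-trunc (suc i) y) i ℕₚ.≤-refl) ⟩
    (x a b i (solution (suc i) y) ≡ᵇ 1)     ≡⟨ cong (_≡ᵇ 1) (solution-parities (suc i) y i ℕₚ.≤-refl) ⟩
    (bitToℕ (y i) ≡ᵇ 1)                     ≡⟨ ≡ᵇ1-bitToℕ (y i) ⟩
    y i                                     ∎
    where
    open ≡-Reasoning
    truncation = + trunc (Ψ y) (suc i)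

  -- Ψ(Φ s) = s: a truncation of s is a solution for Φ s, by the digit formula for Φ.
  Ψ-Φ : ∀ s → Ψ (Φ a b s) ≈ s
  Ψ-Φ s i = begin
    Ψ (Φ a b s) i      ≡⟨ bitℤ-cong i (solution (suc i) (Φ a b s)) truncation
                            (≡-mod-sym {z = truncation} {z' = solution (suc i) (Φ a b s)} truncation≡solution) ⟩
    bitℤ truncation i  ≡⟨ bitℤ-trunc (suc i) s i ℕₚ.≤-refl ⟩
    s i                ∎
    where
    open ≡-Reasoning
    truncation = + trunc s (suc i)
    truncation≡solution : truncation ≡ solution (suc i) (Φ a b s) [mod 2 ℕ.^ suc i ]
    truncation≡solution = solution-unique (suc i) (Φ a b s) truncation λ j j≤i →
      sym (trans (cong bitToℕ (Φ-digit s j (suc i) j≤i)) (bitToℕ-≡ᵇ1 (parities-are-bits truncation j)))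

  Φ-inverse : Inverseᵇ _≈_ _≈_ (Φ a b) Ψ
  Φ-inverse = (λ {y} s≈Ψy → ≈-trans (Φ-cong s≈Ψy) (Φ-Ψ y))
            , (λ {s} y≈Φs → ≈-trans (Ψ-cong y≈Φs) (Ψ-Φ s))

  Φ-isomorphism : IsIso₂ (Cℤ₂ a b) Bℤ₂ (Φ a b)
  Φ-isomorphism = Φ-cong
                , inverseᵇ⇒bijective _≈_ ≈-refl ≈-sym ≈-trans Φ-inverse
                , λ u v → mk⇔ (λ v≈T₂u → ≈-trans (Φ-cong v≈T₂u) (Φ-T₂ u))
                              (λ Φv≈σΦu → Φ-reflects-≈ (≈-trans Φv≈σΦu (≈-sym (Φ-T₂ u))))
    where
    Φ-reflects-≈ : ∀ {s t} → Φ a b s ≈ Φ a b t → s ≈ t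
    Φ-reflects-≈ {s} {t} Φs≈Φt = ≈-trans (≈-sym (Ψ-Φ s)) (≈-trans (Ψ-cong Φs≈Φt) (Ψ-Φ t))

  T₂-conjugate : ∀ s → T₂ a b s ≈ Ψ (σ₂ (Φ a b s))
  T₂-conjugate s = ≈-sym (≈-trans (Ψ-cong (≈-sym (Φ-T₂ s))) (Ψ-Φ (T₂ a b s)))

theorem3 : (a b : ℤ) → Odd a → Odd b →
    ((k : ℕ) → k ≥ 1 →
      Isomorphic (C a b k) (B k) × IsIso (C a b k) (B k) (Φk a b k))
    × Isomorphic₂ (Cℤ₂ a b) Bℤ₂
    × IsIso₂ (Cℤ₂ a b) Bℤ₂ (Φ a b)
    × Σ (ℤ₂ → ℤ₂) (λ Φinv → Congruent _≈_ _≈_ Φinv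
        × Inverseᵇ _≈_ _≈_ (Φ a b) Φinv
        × (∀ n → T₂ a b n ≈ Φinv (σ₂ (Φ a b n))))
theorem3 a b odd-a odd-b =
    (λ k k≥1 → (Φk a b k , Φk-isomorphism k k≥1) , Φk-isomorphism k k≥1)
  , (Φ a b , Φ-isomorphism)
  , Φ-isomorphism
  , (Ψ , Ψ-cong , Φ-inverse , T₂-conjugate)
  where open AnPlusB a b odd-a odd-b
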